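{- Let $a_1,a_2,b_1,b_2$ be positive integers with $a_1\neq a_2$ and $2a_1+b_1=2a_2+b_2$. Then the chain graphs with binary strings $B_1=0\,1^{a_1}0^{a_1}1^{b_1}$ and $B_2=0\,1^{a_2}0^{a_2}1^{b_2}$ are not switching equivalent.
   Context: For a binary string $b=0^{s_1}1^{t_1}0^{s_2}1^{t_2}\cdots 0^{s_k}1^{t_k}$ with all $s_i,t_i\ge 1$ (here $x^{p}$ denotes the symbol $x$ repeated $p$ times), the chain graph with binary string $b$ is the graph on $n=\sum s_i+\sum t_i$ vertices obtained by reading $b$ from left to right and adding one vertex per symbol: a vertex corresponding to a $0$ is added with no edges, and a vertex corresponding to a $1$ is added adjacent to all previously added vertices corresponding to $0$ (and to no other vertex). Switching a graph $G=(V,E)$ on a subset $V'\subseteq V$ means replacing every edge between $V'$ and $V\setminus V'$ by a non-edge and every non-edge between $V'$ and $V\setminus V'$ by an edge, leaving adjacency within $V'$ and within $V\setminus V'$ unchanged. Two graphs are switching equivalent if one is isomorphic to a graph obtained from the other by switching on some vertex subset. -}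

module Defs where

open import Data.Nat using (ℕ; suc; _+_; _<_)
open import Data.Bool using (Bool; true; false; _xor_; _∧_; not; _∨_)
open import Data.Fin using (Fin; toℕ)
open import Data.Vec using (Vec; replicate; _++_; lookup; _∷_; [])
open import Data.Nat using (_<ᵇ_)
open import Relation.Binary.PropositionalEquality using (_≡_)
open import Function.Bundles using (_↔_; Inverse)
open import Data.Product using (Σ; ∃; _×_)

-- A (simple) graph on vertex set Fin n, given by its adjacency predicate
-- (Boolean-valued).  Only the symmetric, irreflexive ones arise below.
Graph : ℕ → Set
Graph n = Fin n → Fin n → Bool

-- Binary strings: false = symbol 0, true = symbol 1.
-- Chain graph of a binary string b of length n: vertex i is the i-th symbol.
-- Vertices i < j (in reading order) are adjacent iff b_i = 0 and b_j = 1,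
-- i.e. the later vertex is a 1 added adjacent to all earlier 0-vertices.
chainGraph : ∀ {n} → Vec Bool n → Graph n
chainGraph b i j =
  ((toℕ i <ᵇ toℕ j) ∧ not (lookup b i) ∧ lookup b j)
  ∨ ((toℕ j <ᵇ toℕ i) ∧ not (lookup b j) ∧ lookup b i)

switch : ∀ {n} → (Fin n → Bool) → Graph n → Graph n
switch S G i j = G i j xor (S i xor S j)

Isomorphic : ∀ {n} → Graph n → Graph n → Set
Isomorphic {n} G H =
  Σ (Fin n ↔ Fin n) λ σ →
    ∀ i j → H (Inverse.to σ i) (Inverse.to σ j) ≡ G i j

SwitchingEquivalent : ∀ {n} → Graph n → Graph n → Set
SwitchingEquivalent {n} G H =
  ∃ λ (S : Fin n → Bool) → Isomorphic (switch S G) H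

string : (a b : ℕ) → Vec Bool (1 + a + a + b)
string a b = ((false ∷ replicate a true) ++ replicate a false) ++ replicate b true

open import Relation.Binary.PropositionalEquality using (cong; sym; trans)
open import Data.Nat.Properties using (+-assoc)
open import Data.Nat using (_*_)

len-eq : ∀ a₁ b₁ a₂ b₂ → 2 * a₁ + b₁ ≡ 2 * a₂ + b₂ →
         1 + a₁ + a₁ + b₁ ≡ 1 + a₂ + a₂ + b₂
len-eq a₁ b₁ a₂ b₂ e = trans (lem a₁ b₁) (trans (cong suc e) (sym (lem a₂ b₂)))
  where
  lem : ∀ a b → 1 + a + a + b ≡ suc (2 * a + b)
  lem a b rewrite Data.Nat.Properties.+-identityʳ a = refl
    where open import Relation.Binary.PropositionalEquality using (refl)

{-# OPTIONS --safe #-}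
module Submission where

-- Switching preserves the parity of the number of edges of every triangle, so for a
-- vertex u the number of vertices w such that every triangle u w x has an even number
-- of edges is a switching invariant.  The chain graph of 0 1^a 0^a 1^b is a blow-up of
-- the chain graph of 0101 along blocks of sizes 1, a, a, b; computing on the four blocks
-- shows that the invariant takes the value b + 1 on the outer blocks and a on the inner
-- ones.  Comparing the values for both strings under 2a₁ + b₁ = 2a₂ + b₂ forces a₁ = a₂.

open import Defs
open import Data.Nat using (ℕ; suc; _+_; _*_; NonZero)
open import Relation.Binary.PropositionalEquality using (_≡_; _≢_; subst)
open import Relation.Nullary using (¬_)
open import Data.Vec using (Vec)
open import Data.Bool using (Bool)

open import Algebra.Bundles using (CommutativeRing)
open import Data.Bool using (true; false; not; _∧_; _∨_; _xor_; if_then_else_)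
open import Data.Bool.Properties
  using (xor-∧-commutativeRing; xor-identityʳ; ∨-comm; ∨-identityʳ; ∧-inverseˡ; ∧-zeroʳ; T-≡; ¬-not)
open import Algebra.Properties.CommutativeSemigroup
  (CommutativeRing.+-commutativeSemigroup xor-∧-commutativeRing) using (interchange)
open import Data.Nat using (zero; _<_; _≤_; _<ᵇ_; _≡ᵇ_; z≤n; s≤s)
open import Data.Nat.Properties
  using ( +-0-commutativeMonoid; +-assoc; +-identityʳ; *-identityʳ; *-suc; *-zeroʳ; +-cancelˡ-≡; +-cancelʳ-≡
        ; *-cancelˡ-≡; <⇒<ᵇ; <ᵇ⇒<; ≤⇒≯; <⇒≱; ≰⇒>; ≤-refl; ≤-<-trans; ≤-trans
        ; m≤m+n; +-monoʳ-<; <⇒≤; <ᵇ-reflects-< )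
open import Data.Nat.Tactic.RingSolver using (solve-∀)
open import Algebra.Properties.CommutativeMonoid.Sum +-0-commutativeMonoid
  using (sum; sum-cong-≗; ∑-permute)
open import Data.Fin as Fin using (Fin; toℕ; _↑ˡ_; _↑ʳ_; splitAt; join) renaming (_<_ to _<ᶠ_; _≤_ to _≤ᶠ_)
open import Data.Fin.Patterns using (0F; 1F; 2F; 3F)
open import Data.Fin.Properties using (<-cmp; toℕ<n; toℕ-↑ˡ; toℕ-↑ʳ; join-splitAt)
open import Data.Vec using (_∷_; []; _++_; lookup; replicate)
open import Data.Vec.Properties using (lookup-++ˡ; lookup-++ʳ; lookup-replicate)
open import Data.Sum using (_⊎_; inj₁; inj₂)
open import Data.Product using (∃; _,_)
open import Function using (_∘_; _↔_; Inverse; Equivalence)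
open import Relation.Binary using (tri<; tri≈; tri>)
open import Relation.Binary.PropositionalEquality using (refl; sym; trans; cong; cong₂; module ≡-Reasoning)
open import Relation.Nullary using (contradiction)
open import Relation.Nullary.Reflects using (ofʸ; ofⁿ)

open ≡-Reasoning

twoGraph : ∀ {n} → Graph n → Fin n → Fin n → Fin n → Bool
twoGraph G i j k = (G i j xor G j k) xor G i k

-- Vertex weights let a blow-up be evaluated on its quotient, a block of size ℓ becoming one
-- vertex of weight ℓ; the graphs of the theorem carry the weight 1 everywhere.
weightedCount : ∀ {n} → (Fin n → ℕ) → (Fin n → Bool) → ℕ
weightedCount m P = sum (λ x → (if P x then 1 else 0) * m x)

pairDegree : ∀ {n} → Graph n → (Fin n → ℕ) → Fin n → Fin n → ℕ
pairDegree G m u w = weightedCount m (twoGraph G u w)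

isolatedPairs : ∀ {n} → Graph n → (Fin n → ℕ) → Fin n → ℕ
isolatedPairs G m u = weightedCount m (λ w → pairDegree G m u w ≡ᵇ 0)

xor-triangle : ∀ x y z → ((x xor y) xor (y xor z)) xor (x xor z) ≡ false
xor-triangle false false false = refl
xor-triangle false false true  = refl
xor-triangle false true  false = refl
xor-triangle false true  true  = refl
xor-triangle true  false false = refl
xor-triangle true  false true  = refl
xor-triangle true  true  false = refl
xor-triangle true  true  true  = refl

twoGraph-switch : ∀ {n} S (G : Graph n) i j k → twoGraph (switch S G) i j k ≡ twoGraph G i j k
twoGraph-switch S G i j k = begin
  ((G i j xor sᵢⱼ) xor (G j k xor sⱼₖ)) xor (G i k xor sᵢₖ)
    ≡⟨ cong (_xor (G i k xor sᵢₖ)) (interchange (G i j) sᵢⱼ (G j k) sⱼₖ) ⟩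
  ((G i j xor G j k) xor (sᵢⱼ xor sⱼₖ)) xor (G i k xor sᵢₖ)
    ≡⟨ interchange (G i j xor G j k) (sᵢⱼ xor sⱼₖ) (G i k) sᵢₖ ⟩
  twoGraph G i j k xor ((sᵢⱼ xor sⱼₖ) xor sᵢₖ)
    ≡⟨ cong (twoGraph G i j k xor_) (xor-triangle (S i) (S j) (S k)) ⟩
  twoGraph G i j k xor false
    ≡⟨ xor-identityʳ (twoGraph G i j k) ⟩
  twoGraph G i j k ∎
  where
  sᵢⱼ sⱼₖ sᵢₖ : Bool
  sᵢⱼ = S i xor S j
  sⱼₖ = S j xor S k
  sᵢₖ = S i xor S k

isolatedPairs-switch : ∀ {n} S (G : Graph n) m u → isolatedPairs (switch S G) m u ≡ isolatedPairs G m u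
isolatedPairs-switch S G m u = sum-cong-≗ λ w → cong (λ d → (if d ≡ᵇ 0 then 1 else 0) * m w)
  (sum-cong-≗ λ x → cong (λ b → (if b then 1 else 0) * m x) (twoGraph-switch S G u w x))

module _ {n k} {G : Graph n} {T : Graph k} (m : Fin n → ℕ) (ℓ : Fin k → ℕ) (β : Fin n → Fin k)
         (G≡T∘β : ∀ i j → G i j ≡ T (β i) (β j))
         (pushforward : ∀ P → weightedCount m (P ∘ β) ≡ weightedCount ℓ P) where

  twoGraph-blowUp : ∀ i j x → twoGraph G i j x ≡ twoGraph T (β i) (β j) (β x)
  twoGraph-blowUp i j x rewrite G≡T∘β i j | G≡T∘β j x | G≡T∘β i x = refl

  pairDegree-blowUp : ∀ u w → pairDegree G m u w ≡ pairDegree T ℓ (β u) (β w)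
  pairDegree-blowUp u w = trans
    (sum-cong-≗ λ x → cong (λ b → (if b then 1 else 0) * m x) (twoGraph-blowUp u w x))
    (pushforward (twoGraph T (β u) (β w)))

  isolatedPairs-blowUp : ∀ u → isolatedPairs G m u ≡ isolatedPairs T ℓ (β u)
  isolatedPairs-blowUp u = trans
    (sum-cong-≗ λ w → cong (λ d → (if d ≡ᵇ 0 then 1 else 0) * m w) (pairDegree-blowUp u w))
    (pushforward (λ t → pairDegree T ℓ (β u) t ≡ᵇ 0))

isolatedPairs-iso : ∀ {n} {G H : Graph n} (σ : Fin n ↔ Fin n) →
  (∀ i j → H (Inverse.to σ i) (Inverse.to σ j) ≡ G i j) →
  ∀ u → isolatedPairs G (λ _ → 1) u ≡ isolatedPairs H (λ _ → 1) (Inverse.to σ u)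
isolatedPairs-iso {H = H} σ iso =
  isolatedPairs-blowUp {T = H} (λ _ → 1) (λ _ → 1) (Inverse.to σ) (λ i j → sym (iso i j)) (λ P → sym (∑-permute (λ t → (if P t then 1 else 0) * 1) σ))

isolatedPairs-switchingEquivalent : ∀ {n} {G H : Graph n} → SwitchingEquivalent G H →
  ∀ u → ∃ λ v → isolatedPairs H (λ _ → 1) v ≡ isolatedPairs G (λ _ → 1) u
isolatedPairs-switchingEquivalent {G = G} {H} (S , σ , iso) u =
  Inverse.to σ u , trans (sym (isolatedPairs-iso {H = H} σ iso u)) (isolatedPairs-switch S G (λ _ → 1) u)

<ᵇ-true : ∀ {m n} → m < n → (m <ᵇ n) ≡ true
<ᵇ-true = Equivalence.to T-≡ ∘ <⇒<ᵇ

<ᵇ-false : ∀ {m n} → n ≤ m → (m <ᵇ n) ≡ false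
<ᵇ-false {m} {n} n≤m = ¬-not λ m<ᵇn → ≤⇒≯ n≤m (<ᵇ⇒< m n (Equivalence.from T-≡ m<ᵇn))

chainGraph-sym : ∀ {n} (v : Vec Bool n) i j → chainGraph v i j ≡ chainGraph v j i
chainGraph-sym v i j = ∨-comm ((toℕ i <ᵇ toℕ j) ∧ not (lookup v i) ∧ lookup v j) _

chainGraph-< : ∀ {n} (v : Vec Bool n) {i j} → i <ᶠ j → chainGraph v i j ≡ not (lookup v i) ∧ lookup v j
chainGraph-< v {i} {j} i<j rewrite <ᵇ-true i<j | <ᵇ-false {toℕ j} {toℕ i} (<⇒≤ i<j) =
  ∨-identityʳ _

chainGraph-equalBits : ∀ {n} (v : Vec Bool n) {i j} → lookup v i ≡ lookup v j → chainGraph v i j ≡ false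
chainGraph-equalBits v {i} {j} vᵢ≡vⱼ
  rewrite vᵢ≡vⱼ | ∧-inverseˡ (lookup v j) | ∧-zeroʳ (toℕ i <ᵇ toℕ j) | ∧-zeroʳ (toℕ j <ᵇ toℕ i) = refl

module _ {n k} (v : Vec Bool n) (w : Vec Bool k) (β : Fin n → Fin k)
         (bits : ∀ i → lookup v i ≡ lookup w (β i)) (mono : ∀ {i j} → i ≤ᶠ j → β i ≤ᶠ β j) where

  private
    chainGraph-blowUp-< : ∀ i j → β i <ᶠ β j → chainGraph v i j ≡ chainGraph w (β i) (β j)
    chainGraph-blowUp-< i j βi<βj = begin
      chainGraph v i j                         ≡⟨ chainGraph-< v (≰⇒> (<⇒≱ βi<βj ∘ mono)) ⟩
      not (lookup v i) ∧ lookup v j            ≡⟨ cong₂ (λ x y → not x ∧ y) (bits i) (bits j) ⟩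
      not (lookup w (β i)) ∧ lookup w (β j)    ≡⟨ chainGraph-< w βi<βj ⟨
      chainGraph w (β i) (β j)                 ∎

  chainGraph-blowUp : ∀ i j → chainGraph v i j ≡ chainGraph w (β i) (β j)
  chainGraph-blowUp i j with <-cmp (β i) (β j)
  ... | tri< βi<βj _ _ = chainGraph-blowUp-< i j βi<βj
  ... | tri≈ _ βi≡βj _ = trans
    (chainGraph-equalBits v (trans (bits i) (trans (cong (lookup w) βi≡βj) (sym (bits j)))))
    (sym (chainGraph-equalBits w (cong (lookup w) βi≡βj)))
  ... | tri> _ _ βj<βi =
    trans (chainGraph-sym v i j) (trans (chainGraph-blowUp-< j i βj<βi) (chainGraph-sym w (β j) (β i)))

sum-↑ : ∀ m {n} (f : Fin (m + n) → ℕ) → sum f ≡ sum (λ i → f (i ↑ˡ n)) + sum (λ j → f (m ↑ʳ j))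
sum-↑ zero f = refl
sum-↑ (suc m) f = trans (cong (f 0F +_) (sum-↑ m (f ∘ Fin.suc))) (sym (+-assoc (f 0F) _ _))

sum-const : ∀ {n c} (f : Fin n → ℕ) → (∀ i → f i ≡ c) → sum f ≡ c * n
sum-const {zero} {c} f _ = sym (*-zeroʳ c)
sum-const {suc n} {c} f f≡c = begin
  f 0F + sum (f ∘ Fin.suc)  ≡⟨ cong₂ _+_ (f≡c 0F) (sum-const (f ∘ Fin.suc) (f≡c ∘ Fin.suc)) ⟩
  c + c * n                 ≡⟨ *-suc c n ⟨
  c * suc n                 ∎

↑-cases : ∀ m {n} {P : Fin (m + n) → Set} → (∀ i → P (i ↑ˡ n)) → (∀ j → P (m ↑ʳ j)) → ∀ k → P k
↑-cases m {n} {P} left right k = subst P (join-splitAt m n k) (byCase (splitAt m k))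
  where
  byCase : ∀ s → P (join m n s)
  byCase (inj₁ i) = left i
  byCase (inj₂ j) = right j

-- The blocks 0F, 1F, 2F, 3F are the runs 0, 1^a, 0^a, 1^b of 0 1^a 0^a 1^b.
blockPattern : Vec Bool 4
blockPattern = false ∷ true ∷ false ∷ true ∷ []

blockSize : ℕ → ℕ → Fin 4 → ℕ
blockSize a b 0F = 1
blockSize a b 1F = a
blockSize a b 2F = a
blockSize a b 3F = b

blockOf : ℕ → ℕ → Fin 4
blockOf a zero    = 0F
blockOf a (suc p) = if p <ᵇ a then 1F else if p <ᵇ a + a then 2F else 3F

blockOf-1 : ∀ {a p} → p < a → blockOf a (suc p) ≡ 1F
blockOf-1 p<a rewrite <ᵇ-true p<a = refl

blockOf-2 : ∀ {a q} → q < a → blockOf a (suc (a + q)) ≡ 2F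
blockOf-2 {a} {q} q<a rewrite <ᵇ-false {a + q} (m≤m+n a q) | <ᵇ-true (+-monoʳ-< a q<a) = refl

blockOf-3 : ∀ {a} q → blockOf a (suc (a + a + q)) ≡ 3F
blockOf-3 {a} q
  rewrite <ᵇ-false {a + a + q} (≤-trans (m≤m+n a a) (m≤m+n (a + a) q))
        | <ᵇ-false {a + a + q} (m≤m+n (a + a) q) = refl

blockOf-mono : ∀ a {p q} → p ≤ q → blockOf a p ≤ᶠ blockOf a q
blockOf-mono a {zero} _ = z≤n
blockOf-mono a {suc p} {suc q} (s≤s p≤q)
  with p <ᵇ a | <ᵇ-reflects-< p a | q <ᵇ a | <ᵇ-reflects-< q a
     | p <ᵇ a + a | <ᵇ-reflects-< p (a + a) | q <ᵇ a + a | <ᵇ-reflects-< q (a + a)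
... | true  | _        | true  | _       | _     | _          | _     | _        = ≤-refl
... | true  | _        | false | _       | _     | _          | true  | _        = s≤s z≤n
... | true  | _        | false | _       | _     | _          | false | _        = s≤s z≤n
... | false | ofⁿ p≮a  | true  | ofʸ q<a | _     | _          | _     | _        =
  contradiction (≤-<-trans p≤q q<a) p≮a
... | false | _        | false | _       | true  | _          | true  | _        = ≤-refl
... | false | _        | false | _       | true  | _          | false | _        = s≤s (s≤s z≤n)
... | false | _        | false | _       | false | ofⁿ p≮2a   | true  | ofʸ q<2a =
  contradiction (≤-<-trans p≤q q<2a) p≮2a
... | false | _        | false | _       | false | _          | false | _        = ≤-refl

module _ (a b : ℕ) where

  block : Fin (1 + a + a + b) → Fin 4
  block i = blockOf a (toℕ i)

  block-1 : ∀ (i : Fin a) → block (Fin.suc ((i ↑ˡ a) ↑ˡ b)) ≡ 1F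
  block-1 i rewrite toℕ-↑ˡ (i ↑ˡ a) b | toℕ-↑ˡ i a = blockOf-1 (toℕ<n i)

  block-2 : ∀ (i : Fin a) → block (Fin.suc ((a ↑ʳ i) ↑ˡ b)) ≡ 2F
  block-2 i rewrite toℕ-↑ˡ (a ↑ʳ i) b | toℕ-↑ʳ a i = blockOf-2 (toℕ<n i)

  block-3 : ∀ (j : Fin b) → block (Fin.suc ((a + a) ↑ʳ j)) ≡ 3F
  block-3 j rewrite toℕ-↑ʳ (a + a) j = blockOf-3 {a} (toℕ j)

  lookup-string : ∀ i → lookup (string a b) i ≡ lookup blockPattern (block i)
  lookup-string 0F = refl
  lookup-string (Fin.suc k) =
    ↑-cases (a + a) {P = P} (↑-cases a {P = P ∘ (_↑ˡ b)} first second) third k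
    where
    ones zeros : Vec Bool a
    ones  = replicate a true
    zeros = replicate a false
    P : Fin (a + a + b) → Set
    P k = lookup (string a b) (Fin.suc k) ≡ lookup blockPattern (block (Fin.suc k))
    first : ∀ i → P ((i ↑ˡ a) ↑ˡ b)
    first i = begin
      lookup ((ones ++ zeros) ++ replicate b true) ((i ↑ˡ a) ↑ˡ b) ≡⟨ lookup-++ˡ (ones ++ zeros) _ (i ↑ˡ a) ⟩
      lookup (ones ++ zeros) (i ↑ˡ a)                              ≡⟨ lookup-++ˡ ones zeros i ⟩
      lookup ones i                                                ≡⟨ lookup-replicate i true ⟩
      true                                                         ≡⟨ cong (lookup blockPattern) (block-1 i) ⟨
      lookup blockPattern (block (Fin.suc ((i ↑ˡ a) ↑ˡ b)))        ∎
    second : ∀ i → P ((a ↑ʳ i) ↑ˡ b)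
    second i = begin
      lookup ((ones ++ zeros) ++ replicate b true) ((a ↑ʳ i) ↑ˡ b) ≡⟨ lookup-++ˡ (ones ++ zeros) _ (a ↑ʳ i) ⟩
      lookup (ones ++ zeros) (a ↑ʳ i)                              ≡⟨ lookup-++ʳ ones zeros i ⟩
      lookup zeros i                                               ≡⟨ lookup-replicate i false ⟩
      false                                                        ≡⟨ cong (lookup blockPattern) (block-2 i) ⟨
      lookup blockPattern (block (Fin.suc ((a ↑ʳ i) ↑ˡ b)))        ∎
    third : ∀ j → P ((a + a) ↑ʳ j)
    third j = begin
      lookup ((ones ++ zeros) ++ replicate b true) ((a + a) ↑ʳ j)  ≡⟨ lookup-++ʳ (ones ++ zeros) _ j ⟩
      lookup (replicate b true) j                                  ≡⟨ lookup-replicate j true ⟩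
      true                                                         ≡⟨ cong (lookup blockPattern) (block-3 j) ⟨
      lookup blockPattern (block (Fin.suc ((a + a) ↑ʳ j)))         ∎

  sum-block : ∀ (f : Fin 4 → ℕ) → sum (f ∘ block) ≡ sum (λ t → f t * blockSize a b t)
  sum-block f = begin
    f 0F + sum g                                      ≡⟨ cong (f 0F +_) runs ⟩
    f 0F + (f 1F * a + f 2F * a + f 3F * b)           ≡⟨ rearrange (f 0F) (f 1F) (f 2F) (f 3F) a b ⟩
    sum (λ t → f t * blockSize a b t)                 ∎
    where
    g : Fin (a + a + b) → ℕ
    g k = f (block (Fin.suc k))
    runs : sum g ≡ f 1F * a + f 2F * a + f 3F * b
    runs = trans (sum-↑ (a + a) g) (cong₂ _+_
      (trans (sum-↑ a (g ∘ (_↑ˡ b))) (cong₂ _+_ (sum-const _ (cong f ∘ block-1)) (sum-const _ (cong f ∘ block-2))))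
      (sum-const _ (cong f ∘ block-3)))
    rearrange : ∀ x y z w a b → x + (y * a + z * a + w * b) ≡ x * 1 + (y * a + (z * a + (w * b + 0)))
    rearrange = solve-∀

  isolatedPairs-string : ∀ i → isolatedPairs (chainGraph (string a b)) (λ _ → 1) i
                               ≡ isolatedPairs (chainGraph blockPattern) (blockSize a b) (block i)
  isolatedPairs-string = isolatedPairs-blowUp {T = chainGraph blockPattern} (λ _ → 1) (blockSize a b) block
    (chainGraph-blowUp (string a b) blockPattern block lookup-string (blockOf-mono a))
    (λ P → trans (sum-cong-≗ λ i → *-identityʳ (if P (block i) then 1 else 0))
                 (sum-block (λ t → if P t then 1 else 0)))

n+0+0≡n : ∀ n → n + 0 + 0 ≡ n
n+0+0≡n n = trans (+-identityʳ (n + 0)) (+-identityʳ n)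

module _ (a b : ℕ) where

  private
    value : Fin 4 → ℕ
    value = isolatedPairs (chainGraph blockPattern) (blockSize (suc a) (suc b))

  isolatedPairs-outerBlock : value 0F ≡ 2 + b
  isolatedPairs-outerBlock = cong (2 +_) (n+0+0≡n b)

  isolatedPairs-innerBlock : value 1F ≡ suc a
  isolatedPairs-innerBlock = cong suc (n+0+0≡n a)

  isolatedPairs-blocks : ∀ t → value t ≡ 2 + b ⊎ value t ≡ suc a
  isolatedPairs-blocks 0F = inj₁ isolatedPairs-outerBlock
  isolatedPairs-blocks 1F = inj₂ isolatedPairs-innerBlock
  isolatedPairs-blocks 2F = inj₂ (cong suc (n+0+0≡n a))
  isolatedPairs-blocks 3F = inj₁ (cong (2 +_) (n+0+0≡n b))

stringGraph : ∀ {n} a b → 1 + a + a + b ≡ n → Graph n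
stringGraph a b e = chainGraph (subst (Vec Bool) e (string a b))

isolatedPairs-stringGraph : ∀ {n} a b .{{_ : NonZero a}} .{{_ : NonZero b}} (e : 1 + a + a + b ≡ n) i →
  isolatedPairs (stringGraph a b e) (λ _ → 1) i ≡ suc b ⊎ isolatedPairs (stringGraph a b e) (λ _ → 1) i ≡ a
isolatedPairs-stringGraph (suc a) (suc b) refl i = subst (λ x → x ≡ 2 + b ⊎ x ≡ suc a)
  (sym (isolatedPairs-string (suc a) (suc b) i)) (isolatedPairs-blocks a b (block (suc a) (suc b) i))

isolatedPairs-stringGraph-outer : ∀ {n} a b .{{_ : NonZero a}} .{{_ : NonZero b}} (e : 1 + a + a + b ≡ n) →
  ∃ λ i → isolatedPairs (stringGraph a b e) (λ _ → 1) i ≡ suc b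
isolatedPairs-stringGraph-outer (suc a) (suc b) refl =
  0F , trans (isolatedPairs-string (suc a) (suc b) 0F) (isolatedPairs-outerBlock a b)

isolatedPairs-stringGraph-inner : ∀ {n} a b .{{_ : NonZero a}} .{{_ : NonZero b}} (e : 1 + a + a + b ≡ n) →
  ∃ λ i → isolatedPairs (stringGraph a b e) (λ _ → 1) i ≡ a
isolatedPairs-stringGraph-inner (suc a) (suc b) refl = i , trans (isolatedPairs-string (suc a) (suc b) i)
  (trans (cong (isolatedPairs (chainGraph blockPattern) (blockSize (suc a) (suc b))) (block-1 (suc a) (suc b) 0F))
         (isolatedPairs-innerBlock a b))
  where
  i : Fin (1 + suc a + suc a + suc b)
  i = Fin.suc ((0F ↑ˡ suc a) ↑ˡ suc b)

a₁≡a₂-from-values : ∀ {a₁ a₂ b₁ b₂} → 2 * a₁ + b₁ ≡ 2 * a₂ + b₂ →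
  suc b₁ ≡ suc b₂ ⊎ suc b₁ ≡ a₂ → a₁ ≡ suc b₂ ⊎ a₁ ≡ a₂ → a₁ ≡ a₂
a₁≡a₂-from-values _ _ (inj₂ a₁≡a₂) = a₁≡a₂
a₁≡a₂-from-values {a₁} {a₂} e (inj₁ refl) (inj₁ _) = *-cancelˡ-≡ a₁ a₂ 2 (+-cancelʳ-≡ _ _ _ e)
a₁≡a₂-from-values {b₁ = b₁} {b₂} e (inj₂ refl) (inj₁ refl) =
  cong suc (+-cancelʳ-≡ 2 b₂ b₁ (+-cancelˡ-≡ (b₂ + b₁) _ _ (begin
    (b₂ + b₁) + (b₂ + 2)   ≡⟨ left b₂ b₁ ⟨
    2 * suc b₂ + b₁        ≡⟨ e ⟩
    2 * suc b₁ + b₂        ≡⟨ right b₂ b₁ ⟩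
    (b₂ + b₁) + (b₁ + 2)   ∎)))
  where
  left : ∀ x y → 2 * suc x + y ≡ (x + y) + (x + 2)
  left = solve-∀
  right : ∀ x y → 2 * suc y + x ≡ (x + y) + (y + 2)
  right = solve-∀

mainTheorem1 : (a₁ a₂ b₁ b₂ : ℕ) → .{{NonZero a₁}} → .{{NonZero a₂}} →
    .{{NonZero b₁}} → .{{NonZero b₂}} → a₁ ≢ a₂ →
    (e : 2 * a₁ + b₁ ≡ 2 * a₂ + b₂) →
    ¬ SwitchingEquivalent
        (chainGraph (subst (Vec Bool) (len-eq a₁ b₁ a₂ b₂ e) (string a₁ b₁)))
        (chainGraph (string a₂ b₂))
mainTheorem1 a₁ a₂ b₁ b₂ a₁≢a₂ e G₁~G₂ = a₁≢a₂ (a₁≡a₂-from-values e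
  (valueOfG₂ (isolatedPairs-stringGraph-outer a₁ b₁ e₁))
  (valueOfG₂ (isolatedPairs-stringGraph-inner a₁ b₁ e₁)))
  where
  e₁ : 1 + a₁ + a₁ + b₁ ≡ 1 + a₂ + a₂ + b₂
  e₁ = len-eq a₁ b₁ a₂ b₂ e
  valueOfG₂ : ∀ {x} → ∃ (λ u → isolatedPairs (stringGraph a₁ b₁ e₁) (λ _ → 1) u ≡ x) →
              x ≡ suc b₂ ⊎ x ≡ a₂
  valueOfG₂ (u , refl) =
    let (v , G₂v≡G₁u) = isolatedPairs-switchingEquivalent
                          {G = stringGraph a₁ b₁ e₁} {H = stringGraph a₂ b₂ refl} G₁~G₂ u
    in subst (λ x → x ≡ suc b₂ ⊎ x ≡ a₂) G₂v≡G₁u (isolatedPairs-stringGraph a₂ b₂ refl v)
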